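{- For $n\ge2$ and $k\in\{1,\dots,2^{n-1}\}$, let $v^n(k)=\operatorname{code}\big(\lambda(\mathrm{decode}_n(2^{n-1}+k-1))\big)$. Then \[ k-1\le \frac{v^n(k)}{2^{\binom{n-1}{2}}}<k, \] with the convention $\binom12=0$.
   Context: For $\mathbf{x}\in\{0,1\}^n$, let $\lambda(\mathbf{x})\in\{0,1\}^{\binom n2}$ have coordinates $\lambda(\mathbf{x})_{ij}=\mathbf{1}(x_i=x_j)$ for $1\le i<j\le n$, listed in lexicographic order of the pairs. For a binary vector $\mathbf{y}=(y_1,\dots,y_m)$, $\operatorname{code}(\mathbf{y})=\sum_{j=1}^m y_j 2^{m-j}$. For $0\le a<2^n$, $\mathrm{decode}_n(a)$ is the $n$-bit binary representation of $a$, padded with leading zeros. -}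

module Defs where

open import Data.Nat using (ℕ; zero; suc; _+_; _*_; _^_; _/_; _%_)
open import Data.Bool using (Bool; true; false; if_then_else_)
open import Data.List using (List; []; _∷_; _++_; map; concatMap; foldl)

-- Bit vectors are lists of Bool, most significant bit first
-- (y₁ is the head of the list).

eqBit : Bool → Bool → Bool
eqBit true  true  = true
eqBit false false = true
eqBit _     _     = false

bitVal : Bool → ℕ
bitVal true  = 1
bitVal false = 0

code : List Bool → ℕ
code = foldl (λ acc b → 2 * acc + bitVal b) 0

-- decode_n(a): the n-bit binary representation of a, leading zeros padded,
-- MSB first. (For a < 2^n this is exact.)
decode : ℕ → ℕ → List Bool
decode zero    a = []
decode (suc n) a = decode n (a / 2) ++ ((a % 2 Data.Nat.≡ᵇ 1) ∷ [])

-- λ(x)_{ij} = 1(x_i = x_j) for i < j, pairs in lexicographic order: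
-- (1,2),(1,3),…,(1,n),(2,3),…
pairEq : List Bool → List Bool
pairEq []       = []
pairEq (x ∷ xs) = map (eqBit x) xs ++ pairEq xs

v : ℕ → ℕ → ℕ
v n k = code (pairEq (decode n (2 ^ (n Data.Nat.∸ 1) + k Data.Nat.∸ 1)))

{-# OPTIONS --safe #-}
module Submission where

open import Defs
open import Data.Nat using (ℕ; zero; suc; _+_; _*_; _∸_; _^_; _≤_; _<_; z≤n; s≤s; _/_; _%_; _≡ᵇ_; NonZero)
open import Data.Nat.Properties
open import Data.Nat.DivMod
open import Data.Nat.Divisibility using (m∣m*n)
open import Data.Nat.Combinatorics using (_C_; nC1≡n; nCk+nC[k+1]≡[n+1]C[k+1])
open import Data.Nat.Tactic.RingSolver using (solve-∀)
open import Data.Bool using (Bool; true; false)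
open import Data.List using (List; []; _∷_; _++_; map; foldl; length)
open import Data.List.Properties using (foldl-++; length-++; length-map)
open import Data.Product using (_×_; _,_)
open import Relation.Binary.PropositionalEquality

-- Write n = m + 1 and k = j + 1. The word decode_n(2^m + j) is a leading 1 followed by
-- t = decode_m(j), and comparing a bit with 1 returns the bit itself, so λ(1 ∷ t) = t ++ λ(t).
-- Hence v^n(k) = j · 2^C(m,2) + code(λ(t)), and the last summand is the code of a word of
-- C(m,2) bits, so it lies in [0, 2^C(m,2)).

horner : ℕ → List Bool → ℕ
horner = foldl (λ acc b → 2 * acc + bitVal b)

horner-code : ∀ acc ys → horner acc ys ≡ acc * 2 ^ length ys + code ys
horner-code acc []       = sym (trans (+-identityʳ _) (*-identityʳ acc))
horner-code acc (y ∷ ys) = begin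
    horner (2 * acc + bitVal y) ys
  ≡⟨ horner-code (2 * acc + bitVal y) ys ⟩
    (2 * acc + bitVal y) * 2 ^ length ys + code ys
  ≡⟨ regroup acc (bitVal y) (2 ^ length ys) (code ys) ⟩
    acc * 2 ^ length (y ∷ ys) + (bitVal y * 2 ^ length ys + code ys)
  ≡⟨ cong (acc * 2 ^ length (y ∷ ys) +_) (horner-code (bitVal y) ys) ⟨
    acc * 2 ^ length (y ∷ ys) + code (y ∷ ys)
  ∎
  where
  open ≡-Reasoning
  regroup : ∀ a b p c → (2 * a + b) * p + c ≡ a * (2 * p) + (b * p + c)
  regroup = solve-∀

code-++ : ∀ xs ys → code (xs ++ ys) ≡ code xs * 2 ^ length ys + code ys
code-++ xs ys = trans (foldl-++ _ 0 xs ys) (horner-code (code xs) ys)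

bitVal≤1 : ∀ b → bitVal b ≤ 1
bitVal≤1 true  = s≤s z≤n
bitVal≤1 false = z≤n

code<2^length : ∀ ys → code ys < 2 ^ length ys
code<2^length []       = s≤s z≤n
code<2^length (y ∷ ys) = begin-strict
    code (y ∷ ys)
  ≡⟨ horner-code (bitVal y) ys ⟩
    bitVal y * P + code ys
  <⟨ +-monoʳ-< (bitVal y * P) (code<2^length ys) ⟩
    bitVal y * P + P
  ≤⟨ +-monoˡ-≤ P (*-monoˡ-≤ P (bitVal≤1 y)) ⟩
    1 * P + P
  ≡⟨ double P ⟩
    2 * P
  ∎
  where
  open ≤-Reasoning
  P = 2 ^ length ys
  double : ∀ p → 1 * p + p ≡ 2 * p
  double = solve-∀

[d*m+n]/d≡m+n/d : ∀ d m n .{{_ : NonZero d}} → (d * m + n) / d ≡ m + n / d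
[d*m+n]/d≡m+n/d d m n = begin
    (d * m + n) / d    ≡⟨ +-distrib-/-∣ˡ n (m∣m*n m) ⟩
    d * m / d + n / d  ≡⟨ cong (_+ n / d) (trans (/-congˡ (*-comm d m)) (m*n/n≡m m d)) ⟩
    m + n / d          ∎
  where open ≡-Reasoning

[d*m+n]%d≡n%d : ∀ d m n .{{_ : NonZero d}} → (d * m + n) % d ≡ n % d
[d*m+n]%d≡n%d d m n = begin
    (d * m + n) % d  ≡⟨ cong (_% d) (trans (+-comm (d * m) n) (cong (n +_) (*-comm d m))) ⟩
    (n + m * d) % d  ≡⟨ [m+kn]%n≡m%n n m d ⟩
    n % d            ∎
  where open ≡-Reasoning

m<2^[1+n]⇒m/2<2^n : ∀ {m} n → m < 2 ^ suc n → m / 2 < 2 ^ n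
m<2^[1+n]⇒m/2<2^n {m} n m< = m<n*o⇒m/o<n (subst (m <_) (*-comm 2 (2 ^ n)) m<)

bitVal-parity : ∀ m → bitVal (m % 2 ≡ᵇ 1) ≡ m % 2
bitVal-parity m = bit (m % 2) (m%n<n m 2)
  where
  bit : ∀ r → r < 2 → bitVal (r ≡ᵇ 1) ≡ r
  bit zero          _ = refl
  bit (suc zero)    _ = refl
  bit (suc (suc r)) (s≤s (s≤s ()))

length-decode : ∀ n a → length (decode n a) ≡ n
length-decode zero    a = refl
length-decode (suc n) a = begin
    length (decode n (a / 2) ++ _)  ≡⟨ length-++ (decode n (a / 2)) ⟩
    length (decode n (a / 2)) + 1  ≡⟨ cong (_+ 1) (length-decode n (a / 2)) ⟩
    n + 1                          ≡⟨ +-comm n 1 ⟩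
    suc n                          ∎
  where open ≡-Reasoning

code-decode : ∀ n a → a < 2 ^ n → code (decode n a) ≡ a
code-decode zero    zero    _        = refl
code-decode zero    (suc a) (s≤s ())
code-decode (suc n) a       a<2^1+n  = begin
    code (decode n (a / 2) ++ ((a % 2 ≡ᵇ 1) ∷ []))
  ≡⟨ code-++ (decode n (a / 2)) ((a % 2 ≡ᵇ 1) ∷ []) ⟩
    code (decode n (a / 2)) * 2 + bitVal (a % 2 ≡ᵇ 1)
  ≡⟨ cong₂ (λ q r → q * 2 + r) (code-decode n (a / 2) (m<2^[1+n]⇒m/2<2^n n a<2^1+n)) (bitVal-parity a) ⟩
    a / 2 * 2 + a % 2
  ≡⟨ trans (+-comm (a / 2 * 2) (a % 2)) (sym (m≡m%n+[m/n]*n a 2)) ⟩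
    a
  ∎
  where open ≡-Reasoning

decode-2^n+ : ∀ n a → a < 2 ^ n → decode (suc n) (2 ^ n + a) ≡ true ∷ decode n a
decode-2^n+ zero    zero    _        = refl
decode-2^n+ zero    (suc a) (s≤s ())
decode-2^n+ (suc n) a       a<2^1+n  = begin
    decode (suc n) ((2 * 2 ^ n + a) / 2) ++ (((2 * 2 ^ n + a) % 2 ≡ᵇ 1) ∷ [])
  ≡⟨ cong₂ (λ q r → decode (suc n) q ++ ((r ≡ᵇ 1) ∷ [])) ([d*m+n]/d≡m+n/d 2 (2 ^ n) a) ([d*m+n]%d≡n%d 2 (2 ^ n) a) ⟩
    decode (suc n) (2 ^ n + a / 2) ++ ((a % 2 ≡ᵇ 1) ∷ [])
  ≡⟨ cong (_++ ((a % 2 ≡ᵇ 1) ∷ [])) (decode-2^n+ n (a / 2) (m<2^[1+n]⇒m/2<2^n n a<2^1+n)) ⟩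
    true ∷ decode n (a / 2) ++ ((a % 2 ≡ᵇ 1) ∷ [])
  ∎
  where open ≡-Reasoning

map-eqBit-true : ∀ xs → map (eqBit true) xs ≡ xs
map-eqBit-true []           = refl
map-eqBit-true (true ∷ xs)  = cong (true ∷_) (map-eqBit-true xs)
map-eqBit-true (false ∷ xs) = cong (false ∷_) (map-eqBit-true xs)

pairEq-true∷ : ∀ xs → pairEq (true ∷ xs) ≡ xs ++ pairEq xs
pairEq-true∷ xs = cong (_++ pairEq xs) (map-eqBit-true xs)

length-pairEq : ∀ xs → length (pairEq xs) ≡ length xs C 2
length-pairEq []       = refl
length-pairEq (x ∷ xs) = begin
    length (map (eqBit x) xs ++ pairEq xs)
  ≡⟨ length-++ (map (eqBit x) xs) ⟩
    length (map (eqBit x) xs) + length (pairEq xs)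
  ≡⟨ cong₂ _+_ (trans (length-map (eqBit x) xs) (sym (nC1≡n (length xs)))) (length-pairEq xs) ⟩
    length xs C 1 + length xs C 2
  ≡⟨ nCk+nC[k+1]≡[n+1]C[k+1] (length xs) 1 ⟩
    suc (length xs) C 2
  ∎
  where open ≡-Reasoning

code-pairEq-decode< : ∀ n a → code (pairEq (decode n a)) < 2 ^ (n C 2)
code-pairEq-decode< n a =
  subst (λ l → code (pairEq t) < 2 ^ l)
        (trans (length-pairEq t) (cong (_C 2) (length-decode n a)))
        (code<2^length (pairEq t))
  where t = decode n a

v-suc-suc : ∀ m j → j < 2 ^ m → v (suc m) (suc j) ≡ j * 2 ^ (m C 2) + code (pairEq (decode m j))
v-suc-suc m j j<2^m = begin
    code (pairEq (decode (suc m) (2 ^ m + suc j ∸ 1)))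
  ≡⟨ cong (λ a → code (pairEq (decode (suc m) (a ∸ 1)))) (+-suc (2 ^ m) j) ⟩
    code (pairEq (decode (suc m) (2 ^ m + j)))
  ≡⟨ cong (λ x → code (pairEq x)) (decode-2^n+ m j j<2^m) ⟩
    code (pairEq (true ∷ t))
  ≡⟨ cong code (pairEq-true∷ t) ⟩
    code (t ++ pairEq t)
  ≡⟨ code-++ t (pairEq t) ⟩
    code t * 2 ^ length (pairEq t) + code (pairEq t)
  ≡⟨ cong₂ (λ q l → q * 2 ^ l + code (pairEq t))
           (code-decode m j j<2^m)
           (trans (length-pairEq t) (cong (_C 2) (length-decode m j))) ⟩
    j * 2 ^ (m C 2) + code (pairEq t)
  ∎
  where
  open ≡-Reasoning
  t = decode m j

between-multiples : ∀ {a r} q d → a ≡ q * d + r → r < d → q * d ≤ a × a < suc q * d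
between-multiples {r = r} q d refl r<d =
  m≤m+n (q * d) r ,
  subst (q * d + r <_) (+-comm (q * d) d) (+-monoʳ-< (q * d) r<d)

proposition3 : (n k : ℕ) → 2 ≤ n → 1 ≤ k → k ≤ 2 ^ (n ∸ 1) →
    ((k ∸ 1) * 2 ^ ((n ∸ 1) C 2) ≤ v n k) × (v n k < k * 2 ^ ((n ∸ 1) C 2))
proposition3 (suc m) (suc j) _ _ j<2^m =
  between-multiples j (2 ^ (m C 2)) (v-suc-suc m j j<2^m) (code-pairEq-decode< m j)
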